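{- Let $m\geq 2$ be an integer and $R\cong \prod_{i=1}^{m}R_{i}$, where each $R_{i}$ is a local Artinian principal ideal ring that is not a field (with finitely many ideals). Then the following statements hold: $1)$ $V(G(R)_{SR})=V(G(R))$. $2)$ For every $I, J \in V(G(R)_{SR})$, if $[I]=[J]$, then $IJ \in E(G(R)_{SR})$. $3)$ For every $I, J\in V(G(R)_{SR})$, if $[I]\neq [J]$, then $IJ \in E(G(R)_{SR})$ if and only if $IJ \notin E(G(R))$.
   Context: All rings are commutative with identity. For a ring $R$, $G(R)$ (the intersection graph of ideals) is the simple graph whose vertices are the non-trivial ideals of $R$ (i.e. ideals other than $0$ and $R$), two distinct vertices being adjacent iff their intersection is non-zero. Two distinct vertices $u,v$ of a graph are mutually maximally distant if $d(v,w)\leq d(u,v)$ for every neighbour $w$ of $u$ and $d(u,w)\leq d(u,v)$ for every neighbour $w$ of $v$. The strong resolving graph $G_{SR}$ of a graph $G$ has as vertices those $u\in V(G)$ for which some $v$ is mutually maximally distant from $u$, and $u,v$ are adjacent in $G_{SR}$ iff they are mutually maximally distant. Here $IJ$ denotes the (possible) edge between vertices $I$ and $J$, not the product ideal. Writing ideals of $R$ as $I=I_{1}\times \cdots \times I_{m}$ and $J=J_{1}\times \cdots \times J_{m}$ with $I_i,J_i$ ideals of $R_i$, define the equivalence relation $\sim$ on $V(G(R))$ by $I\sim J$ iff for every $1\leq i\leq m$, $I_{i}=0$ if and only if $J_{i}=0$; $[I]$ denotes the equivalence class of $I$. -}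

module Defs where

open import Level using (0ℓ)
open import Data.Nat using (ℕ; zero; suc; _≤_)
open import Data.Fin using (Fin)
open import Data.List using (List)
open import Data.List.Membership.Propositional using (_∈_)
open import Data.Product using (Σ; ∃; ∃-syntax; _×_; _,_; proj₁)
open import Relation.Nullary using (¬_)
open import Algebra.Bundles using (CommutativeRing)
open import Algebra.Bundles.Raw using (RawRing)

module _ (R : RawRing 0ℓ 0ℓ) where
  open RawRing R

  record Ideal : Set₁ where
    field
      mem   : Carrier → Set
      resp  : ∀ {x y} → x ≈ y → mem x → mem y
      has0  : mem 0#
      add   : ∀ {x y} → mem x → mem y → mem (x + y)
      neg   : ∀ {x} → mem x → mem (- x)
      mulL  : ∀ r {x} → mem x → mem (r * x)
  open Ideal public

  _⊆ᴵ_ : Ideal → Ideal → Set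
  I ⊆ᴵ J = ∀ x → mem I x → mem J x

  _≐_ : Ideal → Ideal → Set
  I ≐ J = (I ⊆ᴵ J) × (J ⊆ᴵ I)

  NonZeroIdeal : Ideal → Set
  NonZeroIdeal I = ∃[ x ] (mem I x × ¬ (x ≈ 0#))

  Proper : Ideal → Set
  Proper I = ¬ mem I 1#

  NonTrivial : Ideal → Set
  NonTrivial I = NonZeroIdeal I × Proper I

  Principal : Ideal → Set
  Principal I = ∃[ a ] (∀ x → (mem I x → ∃[ r ] (x ≈ r * a)) × (∃[ r ] (x ≈ r * a) → mem I x))

  IsPIR : Set₁
  IsPIR = ∀ (I : Ideal) → Principal I

  Maximal : Ideal → Set₁
  Maximal M = Proper M × (∀ (J : Ideal) → Proper J → M ⊆ᴵ J → J ≐ M)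

  IsLocal : Set₁
  IsLocal = ∃[ M ] (Maximal M × (∀ N → Maximal N → N ≐ M))

  IsArtinian : Set₁
  IsArtinian = ∀ (I : ℕ → Ideal) → (∀ n → I (suc n) ⊆ᴵ I n) →
               ∃[ n ] (∀ k → n ≤ k → I k ≐ I n)

  FinitelyManyIdeals : Set₁
  FinitelyManyIdeals = ∃[ L ] (∀ (I : Ideal) → ∃[ J ] ((J ∈ L) × (I ≐ J)))

  IsField : Set
  IsField = ¬ (1# ≈ 0#) × (∀ x → ¬ (x ≈ 0#) → ∃[ y ] (x * y ≈ 1#))

ΠRing : (m : ℕ) → (Fin m → CommutativeRing 0ℓ 0ℓ) → RawRing 0ℓ 0ℓ
ΠRing m R = record
  { Carrier = (i : Fin m) → CommutativeRing.Carrier (R i)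
  ; _≈_ = λ x y → ∀ i → CommutativeRing._≈_ (R i) (x i) (y i)
  ; _+_ = λ x y i → CommutativeRing._+_ (R i) (x i) (y i)
  ; _*_ = λ x y i → CommutativeRing._*_ (R i) (x i) (y i)
  ; -_  = λ x i → CommutativeRing.-_ (R i) (x i)
  ; 0#  = λ i → CommutativeRing.0# (R i)
  ; 1#  = λ i → CommutativeRing.1# (R i)
  }

module _ (R : RawRing 0ℓ 0ℓ) where
  open RawRing R

  Vertex : Set₁
  Vertex = Σ (Ideal R) (NonTrivial R)

  _≃v_ : Vertex → Vertex → Set
  u ≃v v = _≐_ R (proj₁ u) (proj₁ v)

  Adj : Vertex → Vertex → Set
  Adj u v = ¬ (u ≃v v) × ∃[ x ] (mem (proj₁ u) x × mem (proj₁ v) x × ¬ (x ≈ 0#))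

  -- DistLe u v k  :  d(u,v) ≤ k  (there is a walk of length ≤ k)
  data DistLe : Vertex → Vertex → ℕ → Set₁ where
    here : ∀ {u v k} → u ≃v v → DistLe u v k
    step : ∀ {u w v k} → Adj u w → DistLe w v k → DistLe u v (suc k)

  -- d(a,b) ≤ d(c,d)   (correct also for infinite distances)
  DistLeDist : Vertex → Vertex → Vertex → Vertex → Set₁
  DistLeDist a b c d = ∀ k → DistLe c d k → DistLe a b k

  MMD : Vertex → Vertex → Set₁
  MMD u v = ¬ (u ≃v v)
          × (∀ w → Adj u w → DistLeDist v w u v)
          × (∀ w → Adj v w → DistLeDist u w u v)

  InSR : Vertex → Set₁
  InSR u = ∃[ v ] MMD u v

  EdgeSR : Vertex → Vertex → Set₁
  EdgeSR u v = MMD u v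

module _ (m : ℕ) (R : Fin m → CommutativeRing 0ℓ 0ℓ) where

  CompZero : Ideal (ΠRing m R) → Fin m → Set
  CompZero I i = ∀ x → mem I x → CommutativeRing._≈_ (R i) (x i) (CommutativeRing.0# (R i))

  _∼_ : Vertex (ΠRing m R) → Vertex (ΠRing m R) → Set
  u ∼ v = ∀ i → (CompZero (proj₁ u) i → CompZero (proj₁ v) i) × (CompZero (proj₁ v) i → CompZero (proj₁ u) i)

-- In a local principal ideal ring with finitely many ideals any two non-zero elements have a
-- non-zero common multiple. Hence two ideals of R = ∏ R_i meet non-trivially exactly when both are
-- non-zero in a common component: adjacency in G(R) is read off the supports {i | I_i ≠ 0}.
-- The ideal 𝔪_1 × R_2 × ⋯ × R_m has full support, so G(R) has diameter at most 2 and any two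
-- distinct non-adjacent vertices are mutually maximally distant; vertices with equal supports
-- ([I] = [J]) have the same closed neighbourhoods and are mutually maximally distant too.
-- Conversely, if I_i = 0 ≠ J_i, then J is within distance 1 of the axis 0 × ⋯ × R_i × ⋯ × 0 while
-- I is not, so I and J cannot be both adjacent and mutually maximally distant.
-- The case distinctions are classical; excluded middle follows from R_1 being a principal ideal
-- ring.
module Submission where

open import Defs
open import Level using (0ℓ)
open import Axiom.ExcludedMiddle using (ExcludedMiddle)
open import Axiom.DoubleNegationElimination using (DoubleNegationElimination; em⇒dne)
open import Data.Nat using (ℕ; suc; _≤_; s≤s; z≤n)
open import Data.Fin using (Fin; zero; suc)
open import Data.Fin.Properties using (_≟_)
open import Data.List using (List; []; _∷_)
open import Data.List.Relation.Unary.Any using (here; there)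
open import Data.List.Membership.Propositional using (_∈_)
open import Data.Product using (∃-syntax; _×_; _,_; proj₁; proj₂; swap)
open import Data.Sum using (_⊎_; inj₁; inj₂)
open import Data.Empty using (⊥-elim)
open import Function using (_∘_)
open import Function.Bundles using (_⇔_; mk⇔)
open import Relation.Nullary using (¬_; yes; no)
open import Relation.Binary.PropositionalEquality as ≡ using (_≡_; _≢_)
open import Relation.Unary.Properties using (⊆′-trans; ≐′-refl; ≐′-sym; ≐′-trans)
open import Algebra.Bundles using (CommutativeRing)
open import Algebra.Bundles.Raw using (RawRing)

module IdealTheory (A : CommutativeRing 0ℓ 0ℓ) where
  open CommutativeRing A
  open import Algebra.Properties.Ring ring using (-0#≈0#; -‿distribˡ-*; -‿+-comm)
  open import Algebra.Properties.CommutativeSemigroup +-commutativeSemigroup using (interchange)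
  open import Algebra.Properties.Semiring.Divisibility semiring
    using (_∣_; _,_; _∣0; ∣ʳ-refl; ∣ʳ-trans; ∣ʳ-respʳ-≈; x∣ʳy⇒x∣ʳzy)
  open import Relation.Binary.Reasoning.Setoid setoid

  _⊆_ : Ideal rawRing → Ideal rawRing → Set
  _⊆_ = _⊆ᴵ_ rawRing

  local⇒1≉0 : IsLocal rawRing → 1# ≉ 0#
  local⇒1≉0 (𝔪 , (𝔪-proper , _) , _) 1≈0 = 𝔪-proper (resp 𝔪 (sym 1≈0) (has0 𝔪))

  zeroUnless : Set → Ideal rawRing
  zeroUnless Q = record
    { mem  = λ x → Q ⊎ x ≈ 0#
    ; resp = λ { _ (inj₁ q) → inj₁ q ; x≈y (inj₂ x≈0) → inj₂ (trans (sym x≈y) x≈0) }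
    ; has0 = inj₂ refl
    ; add  = λ { (inj₁ q) _ → inj₁ q ; (inj₂ _) (inj₁ q) → inj₁ q
               ; (inj₂ x≈0) (inj₂ y≈0) → inj₂ (trans (+-cong x≈0 y≈0) (+-identityˡ 0#)) }
    ; neg  = λ { (inj₁ q) → inj₁ q ; (inj₂ x≈0) → inj₂ (trans (-‿cong x≈0) -0#≈0#) }
    ; mulL = λ { _ (inj₁ q) → inj₁ q ; r (inj₂ x≈0) → inj₂ (trans (*-congˡ x≈0) (zeroʳ r)) }
    }

  -- The generator of zeroUnless Q lies in it: either Q holds, or the generator is 0 and then
  -- Q would force 1 ≈ 0.
  pir⇒em : 1# ≉ 0# → IsPIR rawRing → ExcludedMiddle 0ℓ
  pir⇒em 1≉0 pir {Q} with pir (zeroUnless Q)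
  ... | a , generates with proj₂ (generates a) (1# , sym (*-identityˡ a))
  ... | inj₁ q = yes q
  ... | inj₂ a≈0 = no λ q →
          let r , 1≈ra = proj₁ (generates 1#) (inj₁ q)
          in 1≉0 (trans 1≈ra (trans (*-congˡ a≈0) (zeroʳ r)))

  ⟨_⟩ : Carrier → Ideal rawRing
  ⟨ a ⟩ = record
    { mem  = a ∣_
    ; resp = ∣ʳ-respʳ-≈
    ; has0 = a ∣0
    ; add  = λ { (p , pa≈x) (q , qa≈y) → p + q , trans (distribʳ a p q) (+-cong pa≈x qa≈y) }
    ; neg  = λ { (p , pa≈x) → - p , trans (sym (-‿distribˡ-* p a)) (-‿cong pa≈x) }
    ; mulL = λ r → x∣ʳy⇒x∣ʳzy r
    }

  _+ᴵ_ : Ideal rawRing → Ideal rawRing → Ideal rawRing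
  I +ᴵ J = record
    { mem  = λ z → ∃[ x ] ∃[ y ] (mem I x × mem J y × z ≈ x + y)
    ; resp = λ { z≈z′ (x , y , x∈I , y∈J , z≈x+y) → x , y , x∈I , y∈J , trans (sym z≈z′) z≈x+y }
    ; has0 = 0# , 0# , has0 I , has0 J , sym (+-identityˡ 0#)
    ; add  = λ { (x , y , x∈I , y∈J , z≈x+y) (x′ , y′ , x′∈I , y′∈J , z′≈x′+y′) →
                 x + x′ , y + y′ , add I x∈I x′∈I , add J y∈J y′∈J ,
                 trans (+-cong z≈x+y z′≈x′+y′) (interchange x y x′ y′) }
    ; neg  = λ { (x , y , x∈I , y∈J , z≈x+y) → - x , - y , neg I x∈I , neg J y∈J ,
                 trans (-‿cong z≈x+y) (sym (-‿+-comm x y)) }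
    ; mulL = λ { r (x , y , x∈I , y∈J , z≈x+y) → r * x , r * y , mulL I r x∈I , mulL J r y∈J ,
                 trans (*-congˡ z≈x+y) (distribˡ r x y) }
    }

  unit-cancel : ∀ {u c} → u ∣ 1# → u * c ≈ 0# → c ≈ 0#
  unit-cancel {u} {c} (v , vu≈1) uc≈0 = begin
    c            ≈⟨ sym (*-identityˡ c) ⟩
    1# * c       ≈⟨ *-congʳ (sym vu≈1) ⟩
    (v * u) * c  ≈⟨ *-assoc v u c ⟩
    v * (u * c)  ≈⟨ *-congˡ uc≈0 ⟩
    v * 0#       ≈⟨ zeroʳ v ⟩
    0#           ∎

  unit*c≈a⇒a∣c : ∀ {u c a} → u ∣ 1# → u * c ≈ a → a ∣ c
  unit*c≈a⇒a∣c {u} {c} {a} (v , vu≈1) uc≈a = v , (begin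
    v * a        ≈⟨ *-congˡ (sym uc≈a) ⟩
    v * (u * c)  ≈⟨ sym (*-assoc v u c) ⟩
    (v * u) * c  ≈⟨ *-congʳ vu≈1 ⟩
    1# * c       ≈⟨ *-identityˡ c ⟩
    c            ∎)

  NonzeroCommonMultiples : Set
  NonzeroCommonMultiples = ∀ {a b} → a ≉ 0# → b ≉ 0# → ∃[ z ] (a ∣ z × b ∣ z × z ≉ 0#)

  module _ (em : ExcludedMiddle 0ℓ) where
    private
      dne : DoubleNegationElimination 0ℓ
      dne = em⇒dne em

    raise : Ideal rawRing → Ideal rawRing → Ideal rawRing
    raise J K with em {Proper rawRing K × J ⊆ K}
    ... | yes _ = K
    ... | no _  = J

    climb : List (Ideal rawRing) → Ideal rawRing → Ideal rawRing
    climb []      J = J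
    climb (K ∷ L) J = climb L (raise J K)

    ⊆-climb : ∀ L J → J ⊆ climb L J
    ⊆-climb []      J x x∈J = x∈J
    ⊆-climb (K ∷ L) J x x∈J with em {Proper rawRing K × J ⊆ K}
    ... | yes (_ , J⊆K) = ⊆-climb L K x (J⊆K x x∈J)
    ... | no _          = ⊆-climb L J x x∈J

    climb-proper : ∀ L J → Proper rawRing J → Proper rawRing (climb L J)
    climb-proper []      J J-proper = J-proper
    climb-proper (K ∷ L) J J-proper with em {Proper rawRing K × J ⊆ K}
    ... | yes (K-proper , _) = climb-proper L K K-proper
    ... | no _               = climb-proper L J J-proper

    -- The ideals visited by climb increase, so a proper K ⊇ climb L J was climbed onto when
    -- it was met.
    climb-maximal : ∀ L J K → K ∈ L → Proper rawRing K → climb L J ⊆ K → K ⊆ climb L J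
    climb-maximal (K ∷ L) J .K (here ≡.refl) K-proper climb⊆K with em {Proper rawRing K × J ⊆ K}
    ... | yes _   = ⊆-climb L K
    ... | no ¬J⊆K = ⊥-elim (¬J⊆K (K-proper , ⊆′-trans (⊆-climb L J) climb⊆K))
    climb-maximal (K′ ∷ L) J K (there K∈L) K-proper climb⊆K =
      climb-maximal L (raise J K′) K K∈L K-proper climb⊆K

    maximal-above : FinitelyManyIdeals rawRing → ∀ J → Proper rawRing J →
                    ∃[ 𝔫 ] (Maximal rawRing 𝔫 × J ⊆ 𝔫)
    maximal-above (L , cover) J J-proper =
      climb L J , (climb-proper L J J-proper , maximal) , ⊆-climb L J
      where
      maximal : ∀ K′ → Proper rawRing K′ → climb L J ⊆ K′ → _≐_ rawRing K′ (climb L J)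
      maximal K′ K′-proper climb⊆K′ with cover K′
      ... | K , K∈L , K′⊆K , K⊆K′ =
        ⊆′-trans K′⊆K (climb-maximal L J K K∈L (K′-proper ∘ K⊆K′ 1#) (⊆′-trans climb⊆K′ K′⊆K)) ,
        climb⊆K′

    module Local (local : IsLocal rawRing) (finite : FinitelyManyIdeals rawRing) where
      𝔪 : Ideal rawRing
      𝔪 = proj₁ local

      𝔪-proper : Proper rawRing 𝔪
      𝔪-proper = proj₁ (proj₁ (proj₂ local))

      ∉𝔪⇒unit : ∀ {x} → ¬ mem 𝔪 x → x ∣ 1#
      ∉𝔪⇒unit {x} x∉𝔪 = dne λ x∤1 →
        let 𝔫 , 𝔫-maximal , ⟨x⟩⊆𝔫 = maximal-above finite ⟨ x ⟩ x∤1
        in x∉𝔪 (proj₁ (proj₂ (proj₂ local) 𝔫 𝔫-maximal) x (⟨x⟩⊆𝔫 x ∣ʳ-refl))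

      𝔪-nonzero : ¬ IsField rawRing → NonZeroIdeal rawRing 𝔪
      𝔪-nonzero ¬field = dne λ 𝔪≈0 → ¬field (local⇒1≉0 local , λ x x≉0 →
        let y , yx≈1 = ∉𝔪⇒unit (λ x∈𝔪 → 𝔪≈0 (x , x∈𝔪 , x≉0)) in y , trans (*-comm x y) yx≈1)

      fixed-by-𝔪⇒0 : ∀ {d c} → mem 𝔪 d → d * c ≈ c → c ≈ 0#
      fixed-by-𝔪⇒0 {d} {c} d∈𝔪 dc≈c = unit-cancel (∉𝔪⇒unit 1-d∉𝔪) (begin
        (1# - d) * c        ≈⟨ distribʳ c 1# (- d) ⟩
        1# * c + - d * c    ≈⟨ +-cong (*-identityˡ c) (sym (-‿distribˡ-* d c)) ⟩
        c - d * c           ≈⟨ +-congˡ (-‿cong dc≈c) ⟩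
        c - c               ≈⟨ -‿inverseʳ c ⟩
        0#                  ∎)
        where
        1-d∉𝔪 : ¬ mem 𝔪 (1# - d)
        1-d∉𝔪 1-d∈𝔪 = 𝔪-proper (resp 𝔪
          (trans (+-assoc 1# (- d) d) (trans (+-congˡ (-‿inverseˡ d)) (+-identityʳ 1#)))
          (add 𝔪 1-d∈𝔪 d∈𝔪))

      -- With (a) + (b) = (c), a = α c and b = β c: if α or β is a unit, one of a, b divides
      -- the other; otherwise c = (p α + q β) c with p α + q β ∈ 𝔪, forcing c = 0.
      nonzeroCommonMultiples : IsPIR rawRing → NonzeroCommonMultiples
      nonzeroCommonMultiples pir {a} {b} a≉0 b≉0 with pir (⟨ a ⟩ +ᴵ ⟨ b ⟩)
      ... | c , generates
        with proj₁ (generates a) (a , 0# , ∣ʳ-refl , b ∣0 , sym (+-identityʳ a))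
           | proj₁ (generates b) (0# , b , a ∣0 , ∣ʳ-refl , sym (+-identityˡ b))
           | proj₂ (generates c) (1# , sym (*-identityˡ c))
      ... | α , a≈αc | β , b≈βc | x , y , (p , pa≈x) , (q , qb≈y) , c≈x+y
        with em {mem 𝔪 α} | em {mem 𝔪 β}
      ... | no α∉𝔪 | _ =
        b , ∣ʳ-trans (unit*c≈a⇒a∣c (∉𝔪⇒unit α∉𝔪) (sym a≈αc)) (β , sym b≈βc) , ∣ʳ-refl , b≉0
      ... | yes _ | no β∉𝔪 =
        a , ∣ʳ-refl , ∣ʳ-trans (unit*c≈a⇒a∣c (∉𝔪⇒unit β∉𝔪) (sym b≈βc)) (α , sym a≈αc) , a≉0
      ... | yes α∈𝔪 | yes β∈𝔪 = ⊥-elim (a≉0 (trans a≈αc (trans (*-congˡ c≈0) (zeroʳ α))))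
        where
        c≈0 : c ≈ 0#
        c≈0 = fixed-by-𝔪⇒0 (add 𝔪 (mulL 𝔪 p α∈𝔪) (mulL 𝔪 q β∈𝔪)) (begin
          (p * α + q * β) * c        ≈⟨ distribʳ c (p * α) (q * β) ⟩
          p * α * c + q * β * c      ≈⟨ +-cong (*-assoc p α c) (*-assoc q β c) ⟩
          p * (α * c) + q * (β * c)  ≈⟨ +-cong (*-congˡ (sym a≈αc)) (*-congˡ (sym b≈βc)) ⟩
          p * a + q * b              ≈⟨ +-cong pa≈x qb≈y ⟩
          x + y                      ≈⟨ sym c≈x+y ⟩
          c                          ∎)

module IntersectionGraph (P : RawRing 0ℓ 0ℓ) where
  open import Data.Nat using (_+_)
  open import Relation.Unary using (Pred; _≐′_)
  open RawRing P using (Carrier; _≈_; 0#)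
  open import Data.Nat.Properties using (m≤n+m)

  private
    _≃_ : Vertex P → Vertex P → Set
    _≃_ = _≃v_ P

    variable
      u v w : Vertex P
      j k : ℕ

  -- Adj P u v unfolds to Meet (mem (proj₁ u)) (mem (proj₁ v)); stating the adjacency lemmas for
  -- Meet lets Agda infer the ideals, which it cannot recover from the vertices.
  private
    Meet : Pred Carrier 0ℓ → Pred Carrier 0ℓ → Set
    Meet A B = ¬ (A ≐′ B) × ∃[ x ] (A x × B x × ¬ x ≈ 0#)

    variable
      A B C : Pred Carrier 0ℓ

  Adj-sym : Meet A B → Meet B A
  Adj-sym (A≄B , x , x∈A , x∈B , x≉0) = A≄B ∘ ≐′-sym , x , x∈B , x∈A , x≉0

  Adj-respʳ : Meet A B → B ≐′ C → Meet A C
  Adj-respʳ (A≄B , x , x∈A , x∈B , x≉0) B≐C =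
    (λ A≐C → A≄B (≐′-trans A≐C (≐′-sym B≐C))) , x , x∈A , proj₁ B≐C x x∈B , x≉0

  Adj-respˡ : A ≐′ C → Meet A B → Meet C B
  Adj-respˡ A≐C = Adj-sym ∘ (λ ba → Adj-respʳ ba A≐C) ∘ Adj-sym

  DistLe-mono : DistLe P u v j → j ≤ k → DistLe P u v k
  DistLe-mono (here u≃v) _         = here u≃v
  DistLe-mono (step a d) (s≤s j≤k) = step a (DistLe-mono d j≤k)

  DistLe-respˡ : u ≃ w → DistLe P w v k → DistLe P u v k
  DistLe-respˡ u≃w (here w≃v) = here (≐′-trans u≃w w≃v)
  DistLe-respˡ u≃w (step a d) = step (Adj-respˡ (≐′-sym u≃w) a) d

  DistLe-respʳ : DistLe P u v k → v ≃ w → DistLe P u w k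
  DistLe-respʳ (here u≃v) v≃w = here (≐′-trans u≃v v≃w)
  DistLe-respʳ (step a d) v≃w = step a (DistLe-respʳ d v≃w)

  DistLe-trans : DistLe P u w j → DistLe P w v k → DistLe P u v (j + k)
  DistLe-trans {j = j} {k = k} (here u≃w) d = DistLe-mono (DistLe-respˡ u≃w d) (m≤n+m k j)
  DistLe-trans (step a d) d′ = step a (DistLe-trans d d′)

  Adj⇒DistLe : Adj P u v → DistLe P u v (suc k)
  Adj⇒DistLe {v = v} a = step {w = v} a (here ≐′-refl)

  DistLe₁⇒≃⊎Adj : DistLe P u v 1 → u ≃ v ⊎ Adj P u v
  DistLe₁⇒≃⊎Adj (here u≃v)          = inj₁ u≃v
  DistLe₁⇒≃⊎Adj (step a (here w≃v)) = inj₂ (Adj-respʳ a w≃v)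

  DistLe₁-sym : DistLe P u v 1 → DistLe P v u 1
  DistLe₁-sym d with DistLe₁⇒≃⊎Adj d
  ... | inj₁ u≃v = here (≐′-sym u≃v)
  ... | inj₂ a   = Adj⇒DistLe (Adj-sym a)

  ≄⇒1≤ : ¬ u ≃ v → DistLe P u v k → 1 ≤ k
  ≄⇒1≤ u≄v (here u≃v) = ⊥-elim (u≄v u≃v)
  ≄⇒1≤ u≄v (step _ _) = s≤s z≤n

  ≄∧¬Adj⇒2≤ : ¬ u ≃ v → ¬ Adj P u v → DistLe P u v k → 2 ≤ k
  ≄∧¬Adj⇒2≤ u≄v _   (here u≃v)          = ⊥-elim (u≄v u≃v)
  ≄∧¬Adj⇒2≤ _   ¬uv (step a (here w≃v)) = ⊥-elim (¬uv (Adj-respʳ a w≃v))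
  ≄∧¬Adj⇒2≤ _   _   (step _ (step _ _)) = s≤s (s≤s z≤n)

  nonAdjacent⇒MMD : (∀ u v → DistLe P u v 2) → ¬ u ≃ v → ¬ Adj P u v → MMD P u v
  nonAdjacent⇒MMD {u} {v} diameter≤2 u≄v ¬uv =
    u≄v ,
    (λ w _ _ d → DistLe-mono (diameter≤2 v w) (≄∧¬Adj⇒2≤ u≄v ¬uv d)) ,
    (λ w _ _ d → DistLe-mono (diameter≤2 u w) (≄∧¬Adj⇒2≤ u≄v ¬uv d))

  twins⇒MMD : ¬ u ≃ v → (∀ w → Adj P u w → DistLe P v w 1) → (∀ w → Adj P v w → DistLe P u w 1) →
              MMD P u v
  twins⇒MMD u≄v uw⇒vw vw⇒uw =
    u≄v ,
    (λ w a _ d → DistLe-mono (uw⇒vw w a) (≄⇒1≤ u≄v d)) ,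
    (λ w a _ d → DistLe-mono (vw⇒uw w a) (≄⇒1≤ u≄v d))

  MMD∧DistLe₁⇒DistLe₁ˡ : MMD P u v → DistLe P u v 1 → DistLe P v w 1 → DistLe P u w 1
  MMD∧DistLe₁⇒DistLe₁ˡ mmd uv vw with DistLe₁⇒≃⊎Adj vw
  ... | inj₁ v≃w = DistLe-respʳ uv v≃w
  ... | inj₂ a   = proj₂ (proj₂ mmd) _ a 1 uv

  MMD∧DistLe₁⇒DistLe₁ʳ : MMD P u v → DistLe P u v 1 → DistLe P u w 1 → DistLe P v w 1
  MMD∧DistLe₁⇒DistLe₁ʳ mmd uv uw with DistLe₁⇒≃⊎Adj uw
  ... | inj₁ u≃w = DistLe-respʳ (DistLe₁-sym uv) u≃w
  ... | inj₂ a   = proj₁ (proj₂ mmd) _ a 1 uv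

module ProductIntersectionGraph
  (n : ℕ) (R : Fin (suc (suc n)) → CommutativeRing 0ℓ 0ℓ) (em : ExcludedMiddle 0ℓ)
  (1≉0 : ∀ i → ¬ CommutativeRing._≈_ (R i) (CommutativeRing.1# (R i)) (CommutativeRing.0# (R i)))
  (commonMultiples : ∀ i → IdealTheory.NonzeroCommonMultiples (R i))
  (𝔫 : ∀ i → Ideal (CommutativeRing.rawRing (R i)))
  (𝔫-nontrivial : ∀ i → NonTrivial (CommutativeRing.rawRing (R i)) (𝔫 i))
  where
  open import Algebra.Definitions.RawMagma using (_,_)
  open import Algebra.Properties.Ring using (-0#≈0#)

  private
    m : ℕ
    m = suc (suc n)

    module C (i : Fin m) = CommutativeRing (R i)

    dne : DoubleNegationElimination 0ℓ
    dne = em⇒dne em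

  Π : RawRing 0ℓ 0ℓ
  Π = ΠRing m R

  open RawRing Π using () renaming (Carrier to Element; _*_ to _·_; _≈_ to _≈Π_)
  open IntersectionGraph Π

  private
    _≃_ : Vertex Π → Vertex Π → Set
    _≃_ = _≃v_ Π

  ZeroAt : Element → Fin m → Set
  ZeroAt x i = C._≈_ i (x i) (C.0# i)

  CompNonZero : Ideal Π → Fin m → Set
  CompNonZero I i = ∃[ x ] (mem I x × ¬ ZeroAt x i)

  CompNonZero⇒¬CompZero : ∀ {I i} → CompNonZero I i → ¬ CompZero m R I i
  CompNonZero⇒¬CompZero (x , x∈I , x≉0) I₀ = x≉0 (I₀ x x∈I)

  ¬CompZero⇒CompNonZero : ∀ I i → ¬ CompZero m R I i → CompNonZero I i
  ¬CompZero⇒CompNonZero _ _ ¬I₀ = dne λ ¬I₁ → ¬I₀ λ x x∈I → dne λ x≉0 → ¬I₁ (x , x∈I , x≉0)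

  CompNonZero⇒NonZeroIdeal : ∀ I i → CompNonZero I i → NonZeroIdeal Π I
  CompNonZero⇒NonZeroIdeal _ i (x , x∈I , xᵢ≉0) = x , x∈I , λ x≈0 → xᵢ≉0 (x≈0 i)

  nonzero-component : ∀ {x} → ¬ (∀ i → ZeroAt x i) → ∃[ i ] ¬ ZeroAt x i
  nonzero-component x≉0 = dne λ none → x≉0 λ i → dne λ xᵢ≉0 → none (i , xᵢ≉0)

  support : (u : Vertex Π) → ∃[ i ] CompNonZero (proj₁ u) i
  support (_ , (x , x∈u , x≉0) , _) =
    let i , xᵢ≉0 = nonzero-component x≉0 in i , x , x∈u , xᵢ≉0

  Adj⇒sharedSupport : ∀ {u v} → Adj Π u v →
                      ∃[ i ] (CompNonZero (proj₁ u) i × CompNonZero (proj₁ v) i)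
  Adj⇒sharedSupport (_ , x , x∈u , x∈v , x≉0) =
    let i , xᵢ≉0 = nonzero-component x≉0 in i , (x , x∈u , xᵢ≉0) , (x , x∈v , xᵢ≉0)

  single : (i : Fin m) → C.Carrier i → Element
  single i r j with j ≟ i
  ... | yes ≡.refl = r
  ... | no _       = C.0# j

  single-at : ∀ i r → single i r i ≡ r
  single-at i r with i ≟ i
  ... | yes ≡.refl = ≡.refl
  ... | no i≢i     = ⊥-elim (i≢i ≡.refl)

  single-off : ∀ i r {j} → j ≢ i → single i r j ≡ C.0# j
  single-off i r {j} j≢i with j ≟ i
  ... | yes j≡i = ⊥-elim (j≢i j≡i)
  ... | no _    = ≡.refl

  single-nonzero : ∀ i {r} → ¬ C._≈_ i r (C.0# i) → ¬ ZeroAt (single i r) i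
  single-nonzero i {r} r≉0 = r≉0 ∘ C.trans i (C.reflexive i (≡.sym (single-at i r)))

  single-·ˡ : ∀ i r x → (single i r · x) ≈Π single i (C._*_ i r (x i))
  single-·ˡ i r x j with j ≟ i
  ... | yes ≡.refl = C.refl j
  ... | no _       = C.zeroˡ j (x j)

  single-cong : ∀ i {r s} → C._≈_ i r s → single i r ≈Π single i s
  single-cong i r≈s j with j ≟ i
  ... | yes ≡.refl = r≈s
  ... | no _       = C.refl j

  mem-single : (I : Ideal Π) (i : Fin m) (x : Element) {r z : C.Carrier i} →
               mem I x → C._≈_ i (C._*_ i r (x i)) z → mem I (single i z)
  mem-single I i x {r} x∈I rxᵢ≈z =
    resp I (λ j → C.trans j (single-·ˡ i r x j) (single-cong i rxᵢ≈z j)) (mulL I (single i r) x∈I)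

  sharedSupport⇒Adj : ∀ {u v i} → ¬ u ≃ v → CompNonZero (proj₁ u) i → CompNonZero (proj₁ v) i →
                      Adj Π u v
  sharedSupport⇒Adj {u} {v} {i} u≄v (x , x∈u , xᵢ≉0) (y , y∈v , yᵢ≉0)
    with commonMultiples i xᵢ≉0 yᵢ≉0
  ... | z , (_ , rxᵢ≈z) , (_ , syᵢ≈z) , z≉0 =
    u≄v , single i z , mem-single (proj₁ u) i x x∈u rxᵢ≈z , mem-single (proj₁ v) i y y∈v syᵢ≈z ,
    λ single≈0 → single-nonzero i z≉0 (single≈0 i)

  sharedSupport⇒DistLe₁ : ∀ u v {i} → CompNonZero (proj₁ u) i → CompNonZero (proj₁ v) i →
                          DistLe Π u v 1
  sharedSupport⇒DistLe₁ u v uᵢ≠0 vᵢ≠0 with em {u ≃ v}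
  ... | yes u≃v = here u≃v
  ... | no u≄v  = Adj⇒DistLe (sharedSupport⇒Adj {u} {v} u≄v uᵢ≠0 vᵢ≠0)

  sameSupport⇒MMD : ∀ u v → ¬ u ≃ v →
                    (∀ i → CompNonZero (proj₁ u) i → CompNonZero (proj₁ v) i) →
                    (∀ i → CompNonZero (proj₁ v) i → CompNonZero (proj₁ u) i) → MMD Π u v
  sameSupport⇒MMD u v u≄v u⇒v v⇒u = twins⇒MMD u≄v
    (λ w uw → let i , uᵢ≠0 , wᵢ≠0 = Adj⇒sharedSupport {u} {w} uw
              in sharedSupport⇒DistLe₁ v w (u⇒v i uᵢ≠0) wᵢ≠0)
    (λ w vw → let i , vᵢ≠0 , wᵢ≠0 = Adj⇒sharedSupport {v} {w} vw
              in sharedSupport⇒DistLe₁ u w (v⇒u i vᵢ≠0) wᵢ≠0)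

  other : Fin m → Fin m
  other zero    = suc zero
  other (suc _) = zero

  other-≢ : ∀ i → other i ≢ i
  other-≢ zero    ()
  other-≢ (suc _) ()

  axis : Fin m → Ideal Π
  axis i = record
    { mem  = λ x → ∀ j → j ≢ i → ZeroAt x j
    ; resp = λ x≈y x∈ j j≢i → C.trans j (C.sym j (x≈y j)) (x∈ j j≢i)
    ; has0 = λ j _ → C.refl j
    ; add  = λ x∈ y∈ j j≢i → C.trans j (C.+-cong j (x∈ j j≢i) (y∈ j j≢i)) (C.+-identityˡ j (C.0# j))
    ; neg  = λ x∈ j j≢i → C.trans j (C.-‿cong j (x∈ j j≢i)) (-0#≈0# (C.ring j))
    ; mulL = λ r x∈ j j≢i → C.trans j (C.*-congˡ j (x∈ j j≢i)) (C.zeroʳ j (r j))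
    }

  single∈axis : ∀ i r → mem (axis i) (single i r)
  single∈axis i r j j≢i = C.reflexive j (single-off i r j≢i)

  axis-support : ∀ i → CompNonZero (axis i) i
  axis-support i = single i (C.1# i) , single∈axis i (C.1# i) , single-nonzero i (1≉0 i)

  axisVertex : Fin m → Vertex Π
  axisVertex i =
    axis i ,
    CompNonZero⇒NonZeroIdeal (axis i) i (axis-support i) ,
    (λ 1∈axis → 1≉0 (other i) (1∈axis (other i) (other-≢ i)))

  CompZero⇒far-from-axis : ∀ u {i} → CompZero m R (proj₁ u) i → ¬ DistLe Π u (axisVertex i) 1
  CompZero⇒far-from-axis u {i} u₀ d with DistLe₁⇒≃⊎Adj d
  ... | inj₁ u≃axis = single-nonzero i (1≉0 i) (u₀ _ (proj₂ u≃axis _ (single∈axis i (C.1# i))))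
  ... | inj₂ (_ , x , x∈u , x∈axis , x≉0) = x≉0 vanishes
    where
    vanishes : ∀ j → ZeroAt x j
    vanishes j with j ≟ i
    ... | yes ≡.refl = u₀ x x∈u
    ... | no j≢i     = x∈axis j j≢i

  cylinder : (l : Fin m) → Ideal (C.rawRing l) → Ideal Π
  cylinder l N = record
    { mem  = λ x → mem N (x l)
    ; resp = λ x≈y → resp N (x≈y l)
    ; has0 = has0 N
    ; add  = add N
    ; neg  = neg N
    ; mulL = λ r → mulL N (r l)
    }

  cylinder-support : ∀ l j → CompNonZero (cylinder l (𝔫 l)) j
  cylinder-support l j with j ≟ l
  ... | yes ≡.refl =
    let a , a∈𝔫 , a≉0 = proj₁ (𝔫-nontrivial j)
        single≡a = ≡.sym (single-at j a)
    in single j a , resp (𝔫 j) (C.reflexive j single≡a) a∈𝔫 ,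
       a≉0 ∘ C.trans j (C.reflexive j single≡a)
  ... | no j≢l =
    single j (C.1# j) ,
    resp (𝔫 l) (C.reflexive l (≡.sym (single-off j (C.1# j) (j≢l ∘ ≡.sym)))) (has0 (𝔫 l)) ,
    single-nonzero j (1≉0 j)

  cylinderVertex : Fin m → Vertex Π
  cylinderVertex l =
    cylinder l (𝔫 l) ,
    CompNonZero⇒NonZeroIdeal (cylinder l (𝔫 l)) l (cylinder-support l l) ,
    proj₂ (𝔫-nontrivial l)

  cylinder-distinct : ∀ {l l′} → l′ ≢ l → ¬ cylinderVertex l ≃ cylinderVertex l′
  cylinder-distinct {l} {l′} l′≢l (_ , cyl′⊆cyl) =
    proj₂ (𝔫-nontrivial l)
      (resp (𝔫 l) (C.reflexive l (single-at l (C.1# l)))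
        (cyl′⊆cyl (single l (C.1# l))
          (resp (𝔫 l′) (C.reflexive l′ (≡.sym (single-off l (C.1# l) l′≢l))) (has0 (𝔫 l′)))))

  diameter≤2 : ∀ u v → DistLe Π u v 2
  diameter≤2 u v =
    let i , uᵢ≠0 = support u
        j , vⱼ≠0 = support v
    in DistLe-trans (sharedSupport⇒DistLe₁ u hub uᵢ≠0 (cylinder-support zero i))
                    (sharedSupport⇒DistLe₁ hub v (cylinder-support zero j) vⱼ≠0)
    where
    hub : Vertex Π
    hub = cylinderVertex zero

  fullSupport⇒MMD : ∀ u v → ¬ u ≃ v →
                    (∀ i → CompNonZero (proj₁ u) i) → (∀ i → CompNonZero (proj₁ v) i) → MMD Π u v
  fullSupport⇒MMD u v u≄v u-full v-full =
    sameSupport⇒MMD u v u≄v (λ i _ → v-full i) (λ i _ → u-full i)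

  ¬CompZero⇒fullSupport : ∀ I → ¬ (∃[ i ] CompZero m R I i) → ∀ i → CompNonZero I i
  ¬CompZero⇒fullSupport I ¬I₀ i = ¬CompZero⇒CompNonZero I i (λ I₀ → ¬I₀ (i , I₀))

  every-vertex-in-SR : ∀ u → InSR Π u
  every-vertex-in-SR u with em {∃[ i ] CompZero m R (proj₁ u) i}
  ... | yes (i , u₀) =
    axisVertex i , nonAdjacent⇒MMD diameter≤2 (far ∘ here) (far ∘ Adj⇒DistLe)
    where far = CompZero⇒far-from-axis u u₀
  ... | no ¬u₀ with ¬CompZero⇒fullSupport (proj₁ u) ¬u₀ | em {u ≃ cylinderVertex zero}
  ...   | u-full | no u≄K₀ =
    cylinderVertex zero , fullSupport⇒MMD u _ u≄K₀ u-full (cylinder-support zero)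
  ...   | u-full | yes u≃K₀ =
    cylinderVertex (suc zero) ,
    fullSupport⇒MMD u _ (cylinder-distinct (λ ()) ∘ ≐′-trans (≐′-sym u≃K₀)) u-full
      (cylinder-support (suc zero))

  ∼⇒sameSupport : ∀ u v → _∼_ m R u v → ∀ i → CompNonZero (proj₁ u) i → CompNonZero (proj₁ v) i
  ∼⇒sameSupport u v u∼v i uᵢ≠0 =
    ¬CompZero⇒CompNonZero (proj₁ v) i (CompNonZero⇒¬CompZero {proj₁ u} uᵢ≠0 ∘ proj₂ (u∼v i))

  ∼⇒EdgeSR : ∀ u v → ¬ u ≃ v → _∼_ m R u v → EdgeSR Π u v
  ∼⇒EdgeSR u v u≄v u∼v =
    sameSupport⇒MMD u v u≄v (∼⇒sameSupport u v u∼v) (∼⇒sameSupport v u (swap ∘ u∼v))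

  ≃⇒∼ : ∀ u v → u ≃ v → _∼_ m R u v
  ≃⇒∼ u v (u⊆v , v⊆u) i = (λ u₀ x → u₀ x ∘ v⊆u x) , (λ v₀ x → v₀ x ∘ u⊆v x)

  ≁⇒distinguishingComponent :
    ∀ u v → ¬ _∼_ m R u v →
    ∃[ i ] ((CompZero m R (proj₁ u) i × CompNonZero (proj₁ v) i) ⊎
            (CompNonZero (proj₁ u) i × CompZero m R (proj₁ v) i))
  ≁⇒distinguishingComponent u v u≁v = dne λ none → u≁v λ i →
    (λ u₀ → dne λ ¬v₀ → none (i , inj₁ (u₀ , ¬CompZero⇒CompNonZero (proj₁ v) i ¬v₀))) ,
    (λ v₀ → dne λ ¬u₀ → none (i , inj₂ (¬CompZero⇒CompNonZero (proj₁ u) i ¬u₀ , v₀)))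

  ≁⇒EdgeSR⇔¬Adj : ∀ u v → ¬ _∼_ m R u v → EdgeSR Π u v ⇔ (¬ Adj Π u v)
  ≁⇒EdgeSR⇔¬Adj u v u≁v = mk⇔ MMD⇒¬Adj (nonAdjacent⇒MMD diameter≤2 (u≁v ∘ ≃⇒∼ u v))
    where
    MMD⇒¬Adj : EdgeSR Π u v → ¬ Adj Π u v
    MMD⇒¬Adj mmd uv with ≁⇒distinguishingComponent u v u≁v
    ... | i , inj₁ (u₀ , vᵢ≠0) =
      CompZero⇒far-from-axis u u₀ (MMD∧DistLe₁⇒DistLe₁ˡ mmd (Adj⇒DistLe uv)
        (sharedSupport⇒DistLe₁ v (axisVertex i) vᵢ≠0 (axis-support i)))
    ... | i , inj₂ (uᵢ≠0 , v₀) =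
      CompZero⇒far-from-axis v v₀ (MMD∧DistLe₁⇒DistLe₁ʳ mmd (Adj⇒DistLe uv)
        (sharedSupport⇒DistLe₁ u (axisVertex i) uᵢ≠0 (axis-support i)))

lemma3p2 : (m : ℕ) → 2 ≤ m → (R : Fin m → CommutativeRing 0ℓ 0ℓ) →
    (∀ i → IsLocal (CommutativeRing.rawRing (R i))) →
    (∀ i → IsArtinian (CommutativeRing.rawRing (R i))) →
    (∀ i → IsPIR (CommutativeRing.rawRing (R i))) →
    (∀ i → ¬ IsField (CommutativeRing.rawRing (R i))) →
    (∀ i → FinitelyManyIdeals (CommutativeRing.rawRing (R i))) →
    ((∀ I → InSR (ΠRing m R) I)
    × (∀ I J → InSR (ΠRing m R) I → InSR (ΠRing m R) J → ¬ (_≃v_ (ΠRing m R) I J) →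
         _∼_ m R I J → EdgeSR (ΠRing m R) I J)
    × (∀ I J → InSR (ΠRing m R) I → InSR (ΠRing m R) J → ¬ (_∼_ m R I J) →
         (EdgeSR (ΠRing m R) I J ⇔ (¬ Adj (ΠRing m R) I J))))
lemma3p2 (suc (suc n)) (s≤s (s≤s z≤n)) R local _ pir ¬field finite =
  every-vertex-in-SR , (λ I J _ _ → ∼⇒EdgeSR I J) , (λ I J _ _ → ≁⇒EdgeSR⇔¬Adj I J)
  where
  module Rᵢ i = IdealTheory (R i)

  em : ExcludedMiddle 0ℓ
  em = Rᵢ.pir⇒em zero (Rᵢ.local⇒1≉0 zero (local zero)) (pir zero)

  module Rᵢ-local i = Rᵢ.Local i em (local i) (finite i)

  open ProductIntersectionGraph n R em (λ i → Rᵢ.local⇒1≉0 i (local i))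
    (λ i → Rᵢ-local.nonzeroCommonMultiples i (pir i))
    Rᵢ-local.𝔪 (λ i → Rᵢ-local.𝔪-nonzero i (¬field i) , Rᵢ-local.𝔪-proper i)
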